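{- For the directed cycle $C_n=(v_1,v_2,\dots,v_n,v_1)$ with $n\ge 3$, $\gamma_{so}(C_n)=\lceil 3n/5\rceil$.
   Context: For a digraph $D=(V,A)$, $N^+(v)=\{w: vw\in A\}$, $N^-(v)=\{w: wv\in A\}$. $S\subseteq V$ is out-dominating if every $v\in V\setminus S$ has an in-neighbor in $S$. $S$ is a secure out-dominating set (SODS) if $S$ is out-dominating and for every $v\in V\setminus S$ there is $u\in(N^+(v)\cup N^-(v))\cap S$ such that $(S\setminus\{u\})\cup\{v\}$ is out-dominating; $\gamma_{so}(D)$ is the minimum size of an SODS. -}

module Defs where

open import Data.Nat using (ℕ; suc; _≤_; _+_; _*_)
open import Data.Nat.DivMod using (_%_; _/_)
open import Data.Fin using (Fin; toℕ)
open import Data.Fin.Subset using (Subset; _∈_; _∉_; ∣_∣; _∪_; ⁅_⁆; ∁)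
open import Data.Product using (Σ; ∃; _×_; _,_)
open import Data.Sum using (_⊎_)
open import Relation.Binary.PropositionalEquality using (_≡_)

-- A digraph on vertex set Fin n, given by its arc relation: Arc u w means uw ∈ A.
Digraph : ℕ → Set₁
Digraph n = Fin n → Fin n → Set

_-_+_ : ∀ {n} → Subset n → Fin n → Fin n → Subset n
S - u + v = (S Data.Fin.Subset.∩ ∁ ⁅ u ⁆) ∪ ⁅ v ⁆

OutDominating : ∀ {n} → Digraph n → Subset n → Set
OutDominating {n} A S = (v : Fin n) → v ∉ S → ∃ λ u → u ∈ S × A u v

SODS : ∀ {n} → Digraph n → Subset n → Set
SODS {n} A S =
  OutDominating A S ×
  ((v : Fin n) → v ∉ S →
     ∃ λ u → (A v u ⊎ A u v) × u ∈ S × OutDominating A (S - u + v))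

IsSecureOutDominationNumber : ∀ {n} → Digraph n → ℕ → Set
IsSecureOutDominationNumber {n} A k =
  (∃ λ S → SODS A S × ∣ S ∣ ≡ k) × ((S : Subset n) → SODS A S → k ≤ ∣ S ∣)

-- directed cycle C_n = (v_1, …, v_n, v_1), with v_{i+1} represented by i : Fin n;
-- arcs i → (i+1) mod n
Cycle : (n : ℕ) → Digraph n
Cycle (suc m) i j = toℕ j ≡ (suc (toℕ i)) % (suc m)
Cycle 0 ()

ceil5 : ℕ → ℕ
ceil5 m = (m + 4) / 5

-- In C_n every vertex v has the single in-neighbour v − 1 and the single out-neighbour v + 1.
-- So S is out-dominating iff no two consecutive vertices lie outside S, and a vertex v ∉ S
-- is defended iff v − 2 ∈ S (swap v with v − 1) or v + 2 ∈ S (swap v with v + 1).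
-- These two local conditions force at least three members of S among any five consecutive
-- vertices; summing over the n rotations of such a window gives 5 |S| ≥ 3n.  Conversely
-- the pattern 11010 11010 …, cut to length n, satisfies both conditions (also across the
-- wrap-around, since it starts with 11) and has exactly ⌈3n/5⌉ ones.
module Submission where

open import Defs
open import Data.Bool.Base using (Bool; true; false)
open import Data.Fin.Base using (Fin; toℕ; zero; suc)
open import Data.Fin.Properties using (toℕ-fromℕ<; toℕ-injective; toℕ<n) renaming (_≟_ to _≟ᶠ_)
open import Data.Fin.Subset using (Subset; _∈_; _∉_; ∣_∣; _∩_; _∪_; ⁅_⁆; ∁)
open import Data.Fin.Subset.Properties
  using (_∈?_; x∈p∪q⁻; x∈p∪q⁺; x∈p∩q⁻; x∈p∩q⁺; x∈∁p⇒x∉p; x∉p⇒x∈∁p; x∈⁅x⁆; x∈⁅y⁆⇒x≡y; x≢y⇒x∉⁅y⁆)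
open import Data.Nat.Base using (ℕ; zero; suc; _+_; _*_; _∸_; _≤_; _<_; z≤n; s≤s; NonZero)
open import Data.Nat.Properties
open import Data.Nat.DivMod
open import Data.Nat.Divisibility using (divides)
open import Data.Nat.Tactic.RingSolver using (solve-∀)
open import Data.Product using (∃; _×_; _,_; proj₁)
open import Data.Sum using (_⊎_; inj₁; inj₂)
import Data.Sum as Sum
open import Data.Vec.Base using (Vec; []; _∷_; lookup; tabulate)
open import Data.Vec.Properties using ([]=⇒lookup; lookup⇒[]=; lookup∘tabulate)
open import Function using (_∘_)
open import Relation.Nullary using (yes; no; contradiction)
open import Relation.Binary.PropositionalEquality

sum : ℕ → (ℕ → ℕ) → ℕ
sum zero    f = 0
sum (suc n) f = f 0 + sum n (λ c → f (suc c))

syntax sum n (λ c → e) = ∑[ c < n ] e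

∑-cong : ∀ n {f g : ℕ → ℕ} → (∀ c → f c ≡ g c) → ∑[ c < n ] f c ≡ ∑[ c < n ] g c
∑-cong zero    eq = refl
∑-cong (suc n) eq = cong₂ _+_ (eq 0) (∑-cong n (λ c → eq (suc c)))

∑-mono-≤ : ∀ n {f g : ℕ → ℕ} → (∀ c → f c ≤ g c) → ∑[ c < n ] f c ≤ ∑[ c < n ] g c
∑-mono-≤ zero    le = z≤n
∑-mono-≤ (suc n) le = +-mono-≤ (le 0) (∑-mono-≤ n (λ c → le (suc c)))

∑-const : ∀ n a → ∑[ c < n ] a ≡ n * a
∑-const zero    a = refl
∑-const (suc n) a = cong (a +_) (∑-const n a)

∑-distrib-+ : ∀ n (f g : ℕ → ℕ) → ∑[ c < n ] (f c + g c) ≡ ∑[ c < n ] f c + ∑[ c < n ] g c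
∑-distrib-+ zero    f g = refl
∑-distrib-+ (suc n) f g =
  trans (cong (f 0 + g 0 +_) (∑-distrib-+ n (f ∘ suc) (g ∘ suc))) (+-interchange (f 0) (g 0) _ _)
  where +-interchange : ∀ a b c d → (a + b) + (c + d) ≡ (a + c) + (b + d)
        +-interchange = solve-∀

∑-comm : ∀ m n (f : ℕ → ℕ → ℕ) → ∑[ i < m ] ∑[ j < n ] f i j ≡ ∑[ j < n ] ∑[ i < m ] f i j
∑-comm zero    n f = sym (trans (∑-const n 0) (*-zeroʳ n))
∑-comm (suc m) n f =
  trans (cong (∑[ j < n ] f 0 j +_) (∑-comm m n (f ∘ suc)))
        (sym (∑-distrib-+ n (f 0) (λ j → ∑[ i < m ] f (suc i) j)))

∑-last : ∀ n (f : ℕ → ℕ) → ∑[ c < suc n ] f c ≡ ∑[ c < n ] f c + f n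
∑-last zero    f = +-comm (f 0) 0
∑-last (suc n) f = trans (cong (f 0 +_) (∑-last n (f ∘ suc))) (sym (+-assoc (f 0) _ _))

∑-rotate₁ : ∀ n (g : ℕ → ℕ) → g n ≡ g 0 → ∑[ c < n ] g (suc c) ≡ ∑[ c < n ] g c
∑-rotate₁ n g gn≡g0 = +-cancelʳ-≡ (g 0) _ _ (begin
  ∑[ c < n ] g (suc c) + g 0  ≡⟨ +-comm _ (g 0) ⟩
  ∑[ c < suc n ] g c          ≡⟨ ∑-last n g ⟩
  ∑[ c < n ] g c + g n        ≡⟨ cong (∑[ c < n ] g c +_) gn≡g0 ⟩
  ∑[ c < n ] g c + g 0        ∎)
  where open ≡-Reasoning

∑-rotate : ∀ n (f : ℕ → ℕ) → (∀ c → f (c + n) ≡ f c) → ∀ i → ∑[ c < n ] f (i + c) ≡ ∑[ c < n ] f c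
∑-rotate n f periodic zero    = refl
∑-rotate n f periodic (suc i) = begin
  ∑[ c < n ] f (suc i + c)  ≡⟨ ∑-cong n (λ c → cong f (sym (+-suc i c))) ⟩
  ∑[ c < n ] f (i + suc c)  ≡⟨ ∑-rotate₁ n (λ c → f (i + c)) (trans (periodic i) (cong f (sym (+-identityʳ i)))) ⟩
  ∑[ c < n ] f (i + c)      ≡⟨ ∑-rotate n f periodic i ⟩
  ∑[ c < n ] f c            ∎
  where open ≡-Reasoning

Bool→ℕ : Bool → ℕ
Bool→ℕ true  = 1
Bool→ℕ false = 0

card≡∑ : ∀ {n} (v : Vec Bool n) (g : ℕ → ℕ) →
         (∀ i → g (toℕ i) ≡ Bool→ℕ (lookup v i)) → ∣ v ∣ ≡ ∑[ c < n ] g c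
card≡∑ []          g eq = refl
card≡∑ (true  ∷ v) g eq = cong₂ _+_ (sym (eq zero)) (card≡∑ v (g ∘ suc) (eq ∘ suc))
card≡∑ (false ∷ v) g eq = cong₂ _+_ (sym (eq zero)) (card≡∑ v (g ∘ suc) (eq ∘ suc))

ceil5-least : ∀ {a m} → a ≤ 5 * m → ceil5 a ≤ m
ceil5-least {a} {m} a≤5m = ≤-pred (m<n*o⇒m/o<n a+4<[1+m]*5)
  where
  a+4<[1+m]*5 : a + 4 < suc m * 5
  a+4<[1+m]*5 = subst (_< suc m * 5) (+-comm 4 a) (+-monoʳ-≤ 5 (subst (a ≤_) (*-comm 5 m) a≤5m))

ceil5-+15 : ∀ a → ceil5 (15 + a) ≡ 3 + ceil5 a
ceil5-+15 a = +-distrib-/-∣ˡ {15} (a + 4) {5} (divides 3 refl)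

[m+n%o]%o≡[m+n]%o : ∀ m n o .{{_ : NonZero o}} → (m + n % o) % o ≡ (m + n) % o
[m+n%o]%o≡[m+n]%o m n o = begin
  (m + n % o) % o            ≡⟨ %-distribˡ-+ m (n % o) o ⟩
  (m % o + n % o % o) % o    ≡⟨ cong (λ r → (m % o + r) % o) (m%n%n≡m%n n o) ⟩
  (m % o + n % o) % o        ≡⟨ %-distribˡ-+ m n o ⟨
  (m + n) % o                ∎
  where open ≡-Reasoning

%-suc-injective : ∀ a b n .{{_ : NonZero n}} → suc a % n ≡ suc b % n → a % n ≡ b % n
%-suc-injective a b n@(suc n-1) eq =
  trans (via-suc a) (trans (cong (λ r → (n-1 + r) % n) eq) (sym (via-suc b)))
  where
  via-suc : ∀ x → x % n ≡ (n-1 + suc x % n) % n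
  via-suc x = begin
    x % n                  ≡⟨ [m+n]%n≡m%n x n ⟨
    (x + n) % n            ≡⟨ cong (_% n) (trans (+-comm x n) (sym (+-suc n-1 x))) ⟩
    (n-1 + suc x) % n      ≡⟨ [m+n%o]%o≡[m+n]%o n-1 (suc x) n ⟨
    (n-1 + suc x % n) % n  ∎
    where open ≡-Reasoning

%-pred : ∀ c {a} n .{{_ : NonZero n}} → suc c % n ≡ suc a → c % n ≡ a
%-pred c {a} n eq =
  trans (%-suc-injective c a n (trans eq (sym (m<n⇒m%n≡m 1+a<n)))) (m<n⇒m%n≡m (<-trans (n<1+n a) 1+a<n))
  where
  1+a<n : suc a < n
  1+a<n = subst (_< n) eq (m%n<n (suc c) n)

m≢[d+m]%n : ∀ {m d n} .{{_ : NonZero n}} → m < n → 0 < d → d < n → m ≢ (d + m) % n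
m≢[d+m]%n {m} {d} {n} m<n 0<d d<n eq with d + m <? n
... | yes d+m<n = <-irrefl (trans eq (m<n⇒m%n≡m d+m<n)) (m<n+m m 0<d)
... | no  d+m≮n = <-irrefl (sym eq) (begin-strict
  (d + m) % n      ≡⟨ m≤n⇒[n∸m]%m≡n%m n≤d+m ⟨
  (d + m ∸ n) % n  ≤⟨ m%n≤m (d + m ∸ n) n ⟩
  d + m ∸ n        <⟨ ∸-monoˡ-< (+-monoˡ-< m d<n) n≤d+m ⟩
  n + m ∸ n        ≡⟨ m+n∸m≡n n m ⟩
  m                ∎)
  where
  open ≤-Reasoning
  n≤d+m : n ≤ d + m
  n≤d+m = ≮⇒≥ d+m≮n

module _ {n} {S : Subset n} {u v : Fin n} where

  ∈-swap⁻ : ∀ {x} → x ∈ S - u + v → (x ∈ S × x ≢ u) ⊎ x ≡ v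
  ∈-swap⁻ x∈ with x∈p∪q⁻ (S ∩ ∁ ⁅ u ⁆) ⁅ v ⁆ x∈
  ... | inj₂ x∈⁅v⁆ = inj₂ (x∈⁅y⁆⇒x≡y v x∈⁅v⁆)
  ... | inj₁ x∈S∖u with x∈p∩q⁻ S (∁ ⁅ u ⁆) x∈S∖u
  ...   | x∈S , x∉⁅u⁆ = inj₁ (x∈S , λ { refl → x∈∁p⇒x∉p x∉⁅u⁆ (x∈⁅x⁆ u) })

  ∈-swap⁺ : ∀ {x} → x ∈ S → x ≢ u → x ∈ S - u + v
  ∈-swap⁺ x∈S x≢u = x∈p∪q⁺ (inj₁ (x∈p∩q⁺ (x∈S , x∉p⇒x∈∁p (x≢y⇒x∉⁅y⁆ x≢u))))

  v∈swap : v ∈ S - u + v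
  v∈swap = x∈p∪q⁺ (inj₂ (x∈⁅x⁆ v))

  u∉swap : u ≢ v → u ∉ S - u + v
  u∉swap u≢v u∈ with ∈-swap⁻ u∈
  ... | inj₁ (_ , u≢u) = u≢u refl
  ... | inj₂ u≡v       = u≢v u≡v

  ∉swap : ∀ {x} → x ∉ S → x ≢ v → x ∉ S - u + v
  ∉swap x∉S x≢v x∈ with ∈-swap⁻ x∈
  ... | inj₁ (x∈S , _) = x∉S x∈S
  ... | inj₂ x≡v       = x≢v x≡v

  ∈swap⇒∈ : ∀ {x} → x ∈ S - u + v → x ≢ v → x ∈ S
  ∈swap⇒∈ x∈ x≢v with ∈-swap⁻ x∈
  ... | inj₁ (x∈S , _) = x∈S
  ... | inj₂ x≡v       = contradiction x≡v x≢v

-- Exchanging u for v can only undominate u itself and the out-neighbours of u.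
swap-outDominating : ∀ {n} {D : Digraph n} {S u v} → OutDominating D S →
                     (∃ λ w → w ∈ S - u + v × D w u) →
                     (∀ {x} → D u x → x ∈ S ⊎ x ≡ v) →
                     OutDominating D (S - u + v)
swap-outDominating {S = S} {u} {v} od u-dominated out-of-u x x∉ with x ≟ᶠ u
... | yes refl = u-dominated
... | no x≢u with x ∈? S
...   | yes x∈S = contradiction (∈-swap⁺ x∈S x≢u) x∉
...   | no x∉S with od x x∉S
...     | y , y∈S , y→x with y ≟ᶠ u
...       | no y≢u = y , ∈-swap⁺ y∈S y≢u , y→x
...       | yes refl with out-of-u y→x
...         | inj₁ x∈S = contradiction x∈S x∉S
...         | inj₂ refl = contradiction v∈swap x∉

χ : ∀ {n} → Subset n → Fin n → ℕ
χ S x = Bool→ℕ (lookup S x)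

module _ {n} {S : Subset n} where

  χ-∈ : ∀ {x} → x ∈ S → χ S x ≡ 1
  χ-∈ x∈S = cong Bool→ℕ ([]=⇒lookup x∈S)

  χ-∉ : ∀ {x} → x ∉ S → χ S x ≡ 0
  χ-∉ {x} x∉S with lookup S x in eq
  ... | true  = contradiction (lookup⇒[]= x S eq) x∉S
  ... | false = refl

  χ+χ-≥1 : ∀ {x y} → x ∈ S ⊎ y ∈ S → 1 ≤ χ S x + χ S y
  χ+χ-≥1 {x} {y} (inj₁ x∈S) = subst (λ a → 1 ≤ a + χ S y) (sym (χ-∈ x∈S)) (s≤s z≤n)
  χ+χ-≥1 {x} {y} (inj₂ y∈S) = subst (λ b → 1 ≤ χ S x + b) (sym (χ-∈ y∈S)) (m≤n+m 1 (χ S x))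

-- p enumerates the vertices along the cycle (for C_n, p c = c mod n); indexing positions
-- by ℕ rather than by vertices keeps "two steps ahead" free of wrap-around arithmetic.
module Walk {n} (D : Digraph n) (p : ℕ → Fin n)
            (step       : ∀ c → D (p c) (p (suc c)))
            (in-unique  : ∀ {c u} → D u (p (suc c)) → u ≡ p c)
            (out-unique : ∀ {c w} → D (p c) w → w ≡ p (suc c))
            (p≢p∘suc    : ∀ c → p c ≢ p (suc c))
            (p≢p∘2+     : ∀ c → p c ≢ p (2 + c))
            where

  Dominated : Subset n → Set
  Dominated S = ∀ c → p (suc c) ∉ S → p c ∈ S

  Defended : Subset n → Set
  Defended S = ∀ c → p (2 + c) ∉ S → p c ∈ S ⊎ p (4 + c) ∈ S

  outDominating⇒dominated : ∀ {S} → OutDominating D S → Dominated S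
  outDominating⇒dominated {S} od c v∉ with od (p (suc c)) v∉
  ... | u , u∈S , u→v = subst (_∈ S) (in-unique u→v) u∈S

  module _ {S : Subset n} where

    sods⇒defended : SODS D S → Defended S
    sods⇒defended (_ , secure) c v∉ with secure (p (2 + c)) v∉
    ... | u , inj₂ u→v , _ , od′ with refl ← in-unique u→v =
      inj₁ (∈swap⇒∈ (outDominating⇒dominated od′ c (u∉swap (p≢p∘suc (suc c)))) (p≢p∘2+ c))
    ... | u , inj₁ v→u , _ , od′ with refl ← out-unique v→u | p (4 + c) ∈? S
    ...   | yes w∈S = inj₂ w∈S
    ...   | no  w∉S = contradiction
                        (outDominating⇒dominated od′ (3 + c) (∉swap w∉S (p≢p∘2+ (2 + c) ∘ sym)))
                        (u∉swap (p≢p∘suc (2 + c) ∘ sym))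

    successor-∈ : Dominated S → ∀ c → p c ∉ S → p (suc c) ∈ S
    successor-∈ dom c pc∉ with p (suc c) ∈? S
    ... | yes psc∈S = psc∈S
    ... | no  psc∉S = contradiction (dom c psc∉S) pc∉

    adjacent : Dominated S → ∀ c → p c ∈ S ⊎ p (suc c) ∈ S
    adjacent dom c with p (suc c) ∈? S
    ... | yes psc∈S = inj₂ psc∈S
    ... | no  psc∉S = inj₁ (dom c psc∉S)

    window-≥3 : Dominated S → Defended S → ∀ c → 3 ≤ ∑[ j < 5 ] χ S (p (j + c))
    window-≥3 dom def c with p (2 + c) ∈? S
    ... | yes mid∈S rewrite χ-∈ mid∈S =
      subst (3 ≤_) (regroup (χ S (p c)) (χ S (p (suc c))) (χ S (p (3 + c))) (χ S (p (4 + c))))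
            (+-mono-≤ (χ+χ-≥1 (adjacent dom c)) (s≤s (χ+χ-≥1 (adjacent dom (3 + c)))))
      where
      regroup : ∀ a b d e → (a + b) + suc (d + e) ≡ a + (b + suc (d + (e + 0)))
      regroup = solve-∀
    ... | no mid∉S
      rewrite χ-∉ mid∉S | χ-∈ (dom (suc c) mid∉S) | χ-∈ (successor-∈ dom (2 + c) mid∉S) =
      subst (3 ≤_) (regroup (χ S (p c)) (χ S (p (4 + c)))) (s≤s (s≤s (χ+χ-≥1 (def c mid∉S))))
      where
      regroup : ∀ a e → 2 + (a + e) ≡ a + suc (suc (e + 0))
      regroup = solve-∀

  module _ (covers : ∀ v → ∃ λ c → p (2 + c) ≡ v) {S : Subset n} where

    dominated⇒outDominating : Dominated S → OutDominating D S
    dominated⇒outDominating dom v v∉ with covers v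
    ... | c , refl = p (suc c) , dom (suc c) v∉ , step (suc c)

    dominated∧defended⇒sods : Dominated S → Defended S → SODS D S
    dominated∧defended⇒sods dom def = od , secure
      where
      od : OutDominating D S
      od = dominated⇒outDominating dom
      secure : ∀ v → v ∉ S → ∃ λ u → (D v u ⊎ D u v) × u ∈ S × OutDominating D (S - u + v)
      secure v v∉ with covers v
      ... | c , refl with def c v∉
      ...   | inj₁ pc∈S =
        p (suc c) , inj₂ (step (suc c)) , dom (suc c) v∉ ,
        swap-outDominating od (p c , ∈-swap⁺ pc∈S (p≢p∘suc c) , step c) (inj₂ ∘ out-unique)
      ...   | inj₂ p4∈S =
        p (3 + c) , inj₁ (step (2 + c)) , successor-∈ dom (2 + c) v∉ ,
        swap-outDominating od (p (2 + c) , v∈swap , step (2 + c))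
                           (λ u→x → inj₁ (subst (_∈ S) (sym (out-unique u→x)) p4∈S))

motif : ℕ → Bool
motif 0 = true
motif 1 = true
motif 2 = false
motif 3 = true
motif 4 = false
motif (suc (suc (suc (suc (suc j))))) = motif j

motif-dominated : ∀ j → motif (suc j) ≡ false → motif j ≡ true
motif-dominated 0 ()
motif-dominated 1 _ = refl
motif-dominated 2 ()
motif-dominated 3 _ = refl
motif-dominated 4 ()
motif-dominated (suc (suc (suc (suc (suc j))))) = motif-dominated j

motif-defended : ∀ j → motif (2 + j) ≡ false → motif j ≡ true ⊎ motif (4 + j) ≡ true
motif-defended 0 _ = inj₁ refl
motif-defended 1 ()
motif-defended 2 _ = inj₂ refl
motif-defended 3 ()
motif-defended 4 ()
motif-defended (suc (suc (suc (suc (suc j))))) = motif-defended j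

∑-motif : ∀ n → ∑[ c < n ] Bool→ℕ (motif c) ≡ ceil5 (3 * n)
∑-motif 0 = refl
∑-motif 1 = refl
∑-motif 2 = refl
∑-motif 3 = refl
∑-motif 4 = refl
∑-motif (suc (suc (suc (suc (suc j))))) =
  trans (cong (3 +_) (∑-motif j))
        (sym (trans (cong ceil5 (*-distribˡ-+ 3 5 j)) (ceil5-+15 (3 * j))))

module OnCycle (k : ℕ) where

  N : ℕ
  N = 3 + k

  pos : ℕ → Fin N
  pos c = c mod N

  toℕ-pos : ∀ c → toℕ (pos c) ≡ c % N
  toℕ-pos c = toℕ-fromℕ< (m%n<n c N)

  pos-≡ : ∀ c d → c % N ≡ d % N → pos c ≡ pos d
  pos-≡ c d eq = toℕ-injective (trans (toℕ-pos c) (trans eq (sym (toℕ-pos d))))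

  pos-toℕ : ∀ v → pos (toℕ v) ≡ v
  pos-toℕ v = toℕ-injective (trans (toℕ-pos (toℕ v)) (m<n⇒m%n≡m (toℕ<n v)))

  pos-periodic : ∀ c → pos (c + N) ≡ pos c
  pos-periodic c = pos-≡ (c + N) c ([m+n]%n≡m%n c N)

  pos-covers : ∀ v → ∃ λ c → pos (2 + c) ≡ v
  pos-covers v = toℕ v + suc k , (begin
    pos (2 + (toℕ v + suc k))  ≡⟨ cong pos (trans (+-suc (toℕ v) (2 + k)) (cong suc (+-suc (toℕ v) (suc k)))) ⟨
    pos (toℕ v + N)            ≡⟨ pos-periodic (toℕ v) ⟩
    pos (toℕ v)                ≡⟨ pos-toℕ v ⟩
    v                          ∎)
    where open ≡-Reasoning

  pos≢pos∘+ : ∀ {d} → 0 < d → d < N → ∀ c → pos c ≢ pos (d + c)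
  pos≢pos∘+ {d} 0<d d<N c eq = m≢[d+m]%n (m%n<n c N) 0<d d<N (begin
    c % N             ≡⟨ toℕ-pos c ⟨
    toℕ (pos c)       ≡⟨ cong toℕ eq ⟩
    toℕ (pos (d + c)) ≡⟨ toℕ-pos (d + c) ⟩
    (d + c) % N       ≡⟨ [m+n%o]%o≡[m+n]%o d c N ⟨
    (d + c % N) % N   ∎)
    where open ≡-Reasoning

  cycle-step : ∀ c → Cycle N (pos c) (pos (suc c))
  cycle-step c = begin
    toℕ (pos (suc c))        ≡⟨ toℕ-pos (suc c) ⟩
    suc c % N                ≡⟨ [m+n%o]%o≡[m+n]%o 1 c N ⟨
    suc (c % N) % N          ≡⟨ cong (λ r → suc r % N) (toℕ-pos c) ⟨
    suc (toℕ (pos c)) % N    ∎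
    where open ≡-Reasoning

  cycle-out-unique : ∀ {c w} → Cycle N (pos c) w → w ≡ pos (suc c)
  cycle-out-unique {c} arc = toℕ-injective (trans arc (sym (cycle-step c)))

  cycle-in-unique : ∀ {c u} → Cycle N u (pos (suc c)) → u ≡ pos c
  cycle-in-unique {c} {u} arc =
    sym (trans (pos-≡ c (toℕ u) (%-suc-injective c (toℕ u) N (trans (sym (toℕ-pos (suc c))) arc))) (pos-toℕ u))

  open Walk (Cycle N) pos cycle-step (λ {c} → cycle-in-unique {c}) (λ {c} → cycle-out-unique {c})
            (pos≢pos∘+ (s≤s z≤n) (s≤s (s≤s z≤n))) (pos≢pos∘+ (s≤s z≤n) (s≤s (s≤s (s≤s z≤n))))

  sods-size : ∀ {S} → SODS (Cycle N) S → ceil5 (3 * N) ≤ ∣ S ∣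
  sods-size {S} sods = ceil5-least (begin
    3 * N                              ≡⟨ *-comm 3 N ⟩
    N * 3                              ≡⟨ ∑-const N 3 ⟨
    ∑[ c < N ] 3                       ≤⟨ ∑-mono-≤ N (window-≥3 dom def) ⟩
    ∑[ c < N ] ∑[ j < 5 ] f (j + c)    ≡⟨ ∑-comm N 5 (λ c j → f (j + c)) ⟩
    ∑[ j < 5 ] ∑[ c < N ] f (j + c)    ≡⟨ ∑-cong 5 (∑-rotate N f (cong (χ S) ∘ pos-periodic)) ⟩
    ∑[ j < 5 ] ∑[ c < N ] f c          ≡⟨ ∑-const 5 (∑[ c < N ] f c) ⟩
    5 * ∑[ c < N ] f c                 ≡⟨ cong (5 *_) (card≡∑ S f (cong (χ S) ∘ pos-toℕ)) ⟨
    5 * ∣ S ∣                          ∎)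
    where
    open ≤-Reasoning
    f : ℕ → ℕ
    f c = χ S (pos c)
    dom : Dominated S
    dom = outDominating⇒dominated (proj₁ sods)
    def : Defended S
    def = sods⇒defended sods

  motif-wrap : ∀ {x} → x < 2 + N → motif x ≡ true → motif (x % N) ≡ true
  motif-wrap {x} x<2+N mx with m≤n⇒m<n∨m≡n (≤-pred x<2+N)
  ... | inj₂ refl = cong motif ([m+n]%n≡m%n 1 N)
  ... | inj₁ x<1+N with m≤n⇒m<n∨m≡n (≤-pred x<1+N)
  ...   | inj₁ x<N = trans (cong motif (m<n⇒m%n≡m x<N)) mx
  ...   | inj₂ refl = cong motif (n%n≡0 N)

  motif-dominated-% : ∀ {c} → motif (suc c % N) ≡ false → motif (c % N) ≡ true
  motif-dominated-% {c} m≡false with suc c % N in eq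
  ... | suc a = subst (λ r → motif r ≡ true) (sym (%-pred c N eq)) (motif-dominated a m≡false)

  motif-defended-% : ∀ {c} → motif ((2 + c) % N) ≡ false →
                     motif (c % N) ≡ true ⊎ motif ((4 + c) % N) ≡ true
  motif-defended-% {c} m≡false with (2 + c) % N in eq
  ... | suc (suc a) = Sum.map (subst (λ r → motif r ≡ true) (sym c%N≡a))
                              (subst (λ r → motif r ≡ true) (sym [4+c]%N≡[4+a]%N) ∘ motif-wrap 4+a<2+N)
                              (motif-defended a m≡false)
    where
    c%N≡a : c % N ≡ a
    c%N≡a = %-pred c N (%-pred (suc c) N eq)
    [4+c]%N≡[4+a]%N : (4 + c) % N ≡ (4 + a) % N
    [4+c]%N≡[4+a]%N = trans (sym ([m+n%o]%o≡[m+n]%o 2 (2 + c) N)) (cong (λ r → (2 + r) % N) eq)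
    4+a<2+N : 4 + a < 2 + N
    4+a<2+N = s≤s (s≤s (subst (_< N) eq (m%n<n (2 + c) N)))

  S₀ : Subset N
  S₀ = tabulate (motif ∘ toℕ)

  pos∈S₀ : ∀ c → motif (c % N) ≡ true → pos c ∈ S₀
  pos∈S₀ c mc = lookup⇒[]= (pos c) S₀
    (trans (lookup∘tabulate (motif ∘ toℕ) (pos c)) (trans (cong motif (toℕ-pos c)) mc))

  pos∉S₀ : ∀ c → pos c ∉ S₀ → motif (c % N) ≡ false
  pos∉S₀ c pc∉ with motif (c % N) in mc
  ... | true  = contradiction (pos∈S₀ c mc) pc∉
  ... | false = refl

  S₀-sods : SODS (Cycle N) S₀
  S₀-sods = dominated∧defended⇒sods pos-covers
    (λ c → pos∈S₀ c ∘ motif-dominated-% {c} ∘ pos∉S₀ (suc c))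
    (λ c → Sum.map (pos∈S₀ c) (pos∈S₀ (4 + c)) ∘ motif-defended-% {c} ∘ pos∉S₀ (2 + c))

  ∣S₀∣ : ∣ S₀ ∣ ≡ ceil5 (3 * N)
  ∣S₀∣ = trans (card≡∑ S₀ (Bool→ℕ ∘ motif) (cong Bool→ℕ ∘ sym ∘ lookup∘tabulate (motif ∘ toℕ)))
               (∑-motif N)

proposition4p8 : (n : ℕ) → 3 ≤ n →
    IsSecureOutDominationNumber (Cycle n) (ceil5 (3 * n))
proposition4p8 1 (s≤s ())
proposition4p8 2 (s≤s (s≤s ()))
proposition4p8 (suc (suc (suc k))) _ = (S₀ , S₀-sods , ∣S₀∣) , λ _ → sods-size
  where open OnCycle k
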